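{- Let $N = p^k m^2$ be an odd perfect number, where $p$ is a prime with $p \equiv k \equiv 1 \pmod 4$, $k$ a positive integer, $m$ a positive integer and $\gcd(p,m)=1$. Then $$\frac{3p^2-4p+2}{p(p-1)} < \frac{\sigma(p^k)}{p^k} + \frac{\sigma(m^2)}{m^2} \le \frac{3p^2+2p+1}{p(p+1)}.$$
   Context: $\sigma(n)$ denotes the sum of the positive divisors of $n$. An odd perfect number is an odd positive integer $N$ with $\sigma(N)=2N$. -}

module Defs where

open import Data.Nat using (ℕ; zero; suc; _+_)
open import Data.Nat.Divisibility using (_∣?_)
open import Data.List using (List; filter; upTo; map)
open import Data.Nat.ListAction using (sum)
open import Data.Integer using (+_)
open import Data.Rational using (ℚ; _/_; 0ℚ)

-- σ n = sum of the positive divisors of n (divisors of n lie in 1..n; σ 0 = 0)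
σ : ℕ → ℕ
σ n = sum (filter (_∣? n) (map suc (upTo n)))

-- the rational number a / b (for b > 0; the value at b = 0 is an unused dummy)
frac : ℕ → ℕ → ℚ
frac a zero    = 0ℚ
frac a (suc b) = (+ a) / suc b

{-# OPTIONS --safe #-}
-- Write x = σ(p^k)/p^k. As σ is multiplicative and N is perfect, σ(m²)/m² = 2/x, so the
-- sum to be bounded is f x = x + 2/x. Summing the geometric series of divisors of p^k gives
-- (p − 1) σ(p^k) + 1 = p^(k+1), whence (p + 1)/p ≤ x < p/(p − 1) for k ≥ 1. For p ≥ 5 both
-- endpoints lie below √2, where f is decreasing, so f (p/(p − 1)) < f x ≤ f ((p + 1)/p), and
-- these two values are the stated bounds.

module Submission where

open import Defs
open import Data.Empty using (⊥-elim)
import Data.Integer as ℤ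
import Data.Integer.Properties as ℤ
open import Data.List using (List; []; _∷_; _++_; map; filter; upTo; downFrom; cartesianProduct)
open import Data.List.Membership.Propositional using (_∈_)
open import Data.List.Membership.Propositional.Properties
  using (∈-filter⁺; ∈-filter⁻; ∈-map⁺; ∈-map⁻; ∈-upTo⁺; ∈-downFrom⁺; ∈-downFrom⁻; ∈-cartesianProduct⁺; ∈-cartesianProduct⁻)
open import Data.List.Membership.Propositional.Properties.WithK using (unique∧set⇒bag)
import Data.List.Properties as List
open import Data.List.Relation.Binary.BagAndSetEquality using (∼bag⇒↭)
import Data.List.Relation.Unary.All as All
import Data.List.Relation.Unary.All.Properties as All
open import Data.List.Relation.Unary.AllPairs using ([]; _∷_)
open import Data.List.Relation.Unary.Any using (here; there)
open import Data.List.Relation.Unary.Unique.Propositional using (Unique)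
import Data.List.Relation.Unary.Unique.Propositional.Properties as Unique
open import Data.Nat
open import Data.Nat.Coprimality as Coprime using (Coprime; coprime-divisor; gcd≡1⇒coprime)
open import Data.Nat.Divisibility
open import Data.Nat.GCD using (gcd; gcd[m,n]∣m; gcd[m,n]∣n; gcd-greatest; c*gcd[m,n]≡gcd[cm,cn])
open import Data.Nat.ListAction using (sum)
open import Data.Nat.ListAction.Properties using (sum-↭; sum-++)
open import Data.Nat.Primality using (Prime; ¬prime[0]; ¬prime[1]; prime⇒irreducible; prime⇒nonZero; prime⇒nonTrivial)
open import Data.Nat.Properties
open import Data.Nat.Tactic.RingSolver using (solve)
open import Data.Product using (∃-syntax; _×_; _,_; proj₂; uncurry)
open import Data.Rational as ℚ using (ℚ; toℚᵘ; fromℚᵘ)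
import Data.Rational.Properties as ℚ
open import Data.Rational.Unnormalised as ℚᵘ using (mkℚᵘ; *<*; *≤*)
import Data.Rational.Unnormalised.Properties as ℚᵘ
open import Data.Sum using (inj₁; inj₂)
open import Function using (_∘_)
open import Function.Bundles using (mk⇔)
open import Relation.Binary.Definitions using (tri<; tri≈; tri>)
open import Relation.Binary.PropositionalEquality
open import Relation.Nullary using (yes; no)


frac-< : ∀ {a b c d} → 0 < b → 0 < d → a * d < c * b → frac a b ℚ.< frac c d
frac-< {a} {suc b} {c} {suc d} _ _ ad<cb =
  ℚ.toℚᵘ-cancel-< (ℚᵘ.<-respˡ-≃ (ℚᵘ.≃-sym (ℚ.toℚᵘ-fromℚᵘ (mkℚᵘ (ℤ.+ a) b)))
    (ℚᵘ.<-respʳ-≃ (ℚᵘ.≃-sym (ℚ.toℚᵘ-fromℚᵘ (mkℚᵘ (ℤ.+ c) d)))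
      (*<* (subst₂ ℤ._<_ (ℤ.pos-* a (suc d)) (ℤ.pos-* c (suc b)) (ℤ.+<+ ad<cb)))))

frac-≤ : ∀ {a b c d} → 0 < b → 0 < d → a * d ≤ c * b → frac a b ℚ.≤ frac c d
frac-≤ {a} {suc b} {c} {suc d} _ _ ad≤cb =
  ℚ.toℚᵘ-cancel-≤ (ℚᵘ.≤-respˡ-≃ (ℚᵘ.≃-sym (ℚ.toℚᵘ-fromℚᵘ (mkℚᵘ (ℤ.+ a) b)))
    (ℚᵘ.≤-respʳ-≃ (ℚᵘ.≃-sym (ℚ.toℚᵘ-fromℚᵘ (mkℚᵘ (ℤ.+ c) d)))
      (*≤* (subst₂ ℤ._≤_ (ℤ.pos-* a (suc d)) (ℤ.pos-* c (suc b)) (ℤ.+≤+ ad≤cb)))))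

frac-cong : ∀ {a b c d} → 0 < b → 0 < d → a * d ≡ c * b → frac a b ≡ frac c d
frac-cong 0<b 0<d ad≡cb =
  ℚ.≤-antisym (frac-≤ 0<b 0<d (≤-reflexive ad≡cb)) (frac-≤ 0<d 0<b (≤-reflexive (sym ad≡cb)))

frac-+ : ∀ {a b c d} → 0 < b → 0 < d → frac a b ℚ.+ frac c d ≡ frac (a * d + c * b) (b * d)
frac-+ {a} {suc b} {c} {suc d} _ _ = begin
  frac a (suc b) ℚ.+ frac c (suc d)
    ≡⟨ ℚ.fromℚᵘ-toℚᵘ _ ⟨
  fromℚᵘ (toℚᵘ (frac a (suc b) ℚ.+ frac c (suc d)))
    ≡⟨ ℚ.fromℚᵘ-cong (ℚᵘ.≃-trans (ℚ.toℚᵘ-homo-+ (frac a (suc b)) (frac c (suc d)))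
         (ℚᵘ.+-cong (ℚ.toℚᵘ-fromℚᵘ (mkℚᵘ (ℤ.+ a) b)) (ℚ.toℚᵘ-fromℚᵘ (mkℚᵘ (ℤ.+ c) d)))) ⟩
  fromℚᵘ (mkℚᵘ (ℤ.+ a) b ℚᵘ.+ mkℚᵘ (ℤ.+ c) d)
    ≡⟨ ℚ./-cong (sym numerator) refl ⟩
  frac (a * suc d + c * suc b) (suc b * suc d) ∎
  where
  open ≡-Reasoning
  numerator : ℤ.+ (a * suc d + c * suc b) ≡ ℤ.+ a ℤ.* ℤ.+ suc d ℤ.+ ℤ.+ c ℤ.* ℤ.+ suc b
  numerator = trans (ℤ.pos-+ (a * suc d) (c * suc b)) (cong₂ ℤ._+_ (ℤ.pos-* a (suc d)) (ℤ.pos-* c (suc b)))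

unique-map⁺ : ∀ {A B : Set} {xs : List A} (f : A → B) →
              (∀ {x y} → x ∈ xs → y ∈ xs → f x ≡ f y → x ≡ y) → Unique xs → Unique (map f xs)
unique-map⁺ f f-injective [] = []
unique-map⁺ f f-injective (x∉xs ∷ xs!) =
  All.map⁺ (All.tabulate λ y∈xs fx≡fy → All.lookup x∉xs y∈xs (f-injective (here refl) (there y∈xs) fx≡fy))
  ∷ unique-map⁺ f (λ x∈ y∈ → f-injective (there x∈) (there y∈)) xs!

sum-map-*ˡ : ∀ x ys → sum (map (x *_) ys) ≡ x * sum ys
sum-map-*ˡ x []       = sym (*-zeroʳ x)
sum-map-*ˡ x (y ∷ ys) = trans (cong (x * y +_) (sum-map-*ˡ x ys)) (sym (*-distribˡ-+ x y (sum ys)))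

sum-map-*-cartesianProduct : ∀ xs ys → sum (map (uncurry _*_) (cartesianProduct xs ys)) ≡ sum xs * sum ys
sum-map-*-cartesianProduct []       ys = refl
sum-map-*-cartesianProduct (x ∷ xs) ys = begin
  sum (map (uncurry _*_) (map (x ,_) ys ++ cartesianProduct xs ys))
    ≡⟨ cong sum (List.map-++ (uncurry _*_) (map (x ,_) ys) (cartesianProduct xs ys)) ⟩
  sum (map (uncurry _*_) (map (x ,_) ys) ++ map (uncurry _*_) (cartesianProduct xs ys))
    ≡⟨ sum-++ (map (uncurry _*_) (map (x ,_) ys)) _ ⟩
  sum (map (uncurry _*_) (map (x ,_) ys)) + sum (map (uncurry _*_) (cartesianProduct xs ys))
    ≡⟨ cong₂ _+_ (trans (cong sum (sym (List.map-∘ ys))) (sum-map-*ˡ x ys))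
                 (sum-map-*-cartesianProduct xs ys) ⟩
  x * sum ys + sum xs * sum ys
    ≡⟨ *-distribʳ-+ (sum ys) x (sum xs) ⟨
  (x + sum xs) * sum ys ∎
  where open ≡-Reasoning

coprime-∣ : ∀ {a b c d} → Coprime a b → c ∣ a → d ∣ b → Coprime c d
coprime-∣ a⊥b c∣a d∣b (x∣c , x∣d) = a⊥b (∣-trans x∣c c∣a , ∣-trans x∣d d∣b)

coprime-*ʳ : ∀ {a b c} → Coprime a b → Coprime a c → Coprime a (b * c)
coprime-*ʳ a⊥b a⊥c (x∣a , x∣bc) = a⊥c (x∣a , coprime-divisor (coprime-∣ a⊥b x∣a ∣-refl) x∣bc)

coprime-^ˡ : ∀ {a b} k → Coprime a b → Coprime (a ^ k) b
coprime-^ˡ zero    a⊥b (x∣1 , _) = ∣1⇒≡1 x∣1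
coprime-^ˡ (suc k) a⊥b = Coprime.sym (coprime-*ʳ (Coprime.sym a⊥b) (Coprime.sym (coprime-^ˡ k a⊥b)))

coprime-∣-*⇒≡gcd*gcd : ∀ {a b c} → Coprime a b → c ∣ a * b → c ≡ gcd c a * gcd c b
coprime-∣-*⇒≡gcd*gcd {a} {b} {c} a⊥b c∣ab = ∣-antisym c∣de de∣c
  where
  d = gcd c a
  e = gcd c b
  c∣bd : c ∣ b * d
  c∣bd = subst (c ∣_) (sym (c*gcd[m,n]≡gcd[cm,cn] b c a))
           (gcd-greatest (n∣m*n b) (subst (c ∣_) (*-comm a b) c∣ab))
  c∣de : c ∣ d * e
  c∣de = subst (c ∣_) (sym (c*gcd[m,n]≡gcd[cm,cn] d c b))
           (gcd-greatest (n∣m*n d) (subst (c ∣_) (*-comm b d) c∣bd))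
  d∣c = gcd[m,n]∣m c a
  c≡dq : c ≡ d * quotient d∣c
  c≡dq = m∣n⇒n≡m*quotient d∣c
  e∣q : e ∣ quotient d∣c
  e∣q = coprime-divisor (coprime-∣ (Coprime.sym a⊥b) (gcd[m,n]∣n c b) (gcd[m,n]∣n c a))
          (subst (e ∣_) c≡dq (gcd[m,n]∣m c b))
  de∣c : d * e ∣ c
  de∣c = subst (d * e ∣_) (sym c≡dq) (*-monoʳ-∣ d e∣q)

coprime-divisors-*-injective : ∀ {a b d₁ d₂ e₁ e₂} → 0 < a → Coprime a b →
                               d₁ ∣ a → d₂ ∣ a → e₁ ∣ b → e₂ ∣ b →
                               d₁ * e₁ ≡ d₂ * e₂ → d₁ ≡ d₂ × e₁ ≡ e₂
coprime-divisors-*-injective {d₁ = d₁} {d₂} {e₁} {e₂} 0<a a⊥b d₁∣a d₂∣a e₁∣b e₂∣b d₁e₁≡d₂e₂ =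
  d₁≡d₂ , *-cancelˡ-≡ e₁ e₂ d₁ {{>-nonZero 0<d₁}}
            (trans d₁e₁≡d₂e₂ (cong (_* e₂) (sym d₁≡d₂)))
  where
  0<d₁ : 0 < d₁
  0<d₁ = n≢0⇒n>0 λ { refl → n>0⇒n≢0 0<a (0∣⇒≡0 d₁∣a) }
  d₁≡d₂ : d₁ ≡ d₂
  d₁≡d₂ = ∣-antisym
    (coprime-divisor (coprime-∣ a⊥b d₁∣a e₂∣b)
      (subst (d₁ ∣_) (trans d₁e₁≡d₂e₂ (*-comm d₂ e₂)) (m∣m*n e₁)))
    (coprime-divisor (coprime-∣ a⊥b d₂∣a e₁∣b)
      (subst (d₂ ∣_) (trans (sym d₁e₁≡d₂e₂) (*-comm d₁ e₁)) (m∣m*n e₂)))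

∣-prime^⇒≡^ : ∀ {p d} → Prime p → ∀ k → d ∣ p ^ k → ∃[ i ] i ≤ k × d ≡ p ^ i
∣-prime^⇒≡^ p-prime zero d∣1 = 0 , z≤n , ∣1⇒≡1 d∣1
∣-prime^⇒≡^ {p} {d} p-prime (suc k) d∣p^[1+k] with p ∣? d
... | yes (divides q d≡q*p) =
  let i , i≤k , q≡p^i = ∣-prime^⇒≡^ p-prime k q∣p^k
  in suc i , s≤s i≤k , trans d≡q*p (trans (*-comm q p) (cong (p *_) q≡p^i))
  where
  instance _ = prime⇒nonZero p-prime
  q∣p^k : q ∣ p ^ k
  q∣p^k = *-cancelˡ-∣ p (subst (_∣ p * p ^ k) (trans d≡q*p (*-comm q p)) d∣p^[1+k])
... | no p∤d =
  let i , i≤k , d≡p^i = ∣-prime^⇒≡^ p-prime k (coprime-divisor d⊥p d∣p^[1+k])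
  in i , m≤n⇒m≤1+n i≤k , d≡p^i
  where
  d⊥p : Coprime d p
  d⊥p (x∣d , x∣p) with prime⇒irreducible p-prime x∣p
  ... | inj₁ x≡1 = x≡1
  ... | inj₂ refl = ⊥-elim (p∤d x∣d)

^-monoʳ-∣ : ∀ p {i k} → i ≤ k → p ^ i ∣ p ^ k
^-monoʳ-∣ p {i} i≤k with j , refl ← m≤n⇒∃[o]m+o≡n i≤k =
  subst (p ^ i ∣_) (sym (^-distribˡ-+-* p i j)) (m∣m*n (p ^ j))

^-injectiveʳ : ∀ p → 1 < p → ∀ {i j} → p ^ i ≡ p ^ j → i ≡ j
^-injectiveʳ p 1<p {i} {j} p^i≡p^j with <-cmp i j
... | tri< i<j _ _ = ⊥-elim (<⇒≢ (^-monoʳ-< p 1<p i<j) p^i≡p^j)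
... | tri≈ _ i≡j _ = i≡j
... | tri> _ _ j<i = ⊥-elim (<⇒≢ (^-monoʳ-< p 1<p j<i) (sym p^i≡p^j))

divisors : ℕ → List ℕ
divisors n = filter (_∣? n) (map suc (upTo n))

∈-divisors⁺ : ∀ {n d} → 0 < n → d ∣ n → d ∈ divisors n
∈-divisors⁺ {suc n} {zero} _ 0∣n with () ← 0∣⇒≡0 0∣n
∈-divisors⁺ {suc n} {suc d} _ d∣n = ∈-filter⁺ (_∣? suc n) (∈-map⁺ suc (∈-upTo⁺ (∣⇒≤ d∣n))) d∣n

∈-divisors⁻ : ∀ {n d} → d ∈ divisors n → d ∣ n
∈-divisors⁻ {n} d∈ = proj₂ (∈-filter⁻ (_∣? n) {xs = map suc (upTo n)} d∈)

divisors-unique : ∀ n → Unique (divisors n)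
divisors-unique n = Unique.filter⁺ (_∣? n) (Unique.map⁺ suc-injective (Unique.upTo⁺ n))

σ≡sum : ∀ {n ds} → 0 < n → Unique ds →
        (∀ {d} → d ∈ ds → d ∣ n) → (∀ {d} → d ∣ n → d ∈ ds) → σ n ≡ sum ds
σ≡sum {n} 0<n ds-unique sound complete =
  sum-↭ (∼bag⇒↭ (unique∧set⇒bag (divisors-unique n) ds-unique
    (mk⇔ (complete ∘ ∈-divisors⁻) (∈-divisors⁺ 0<n ∘ sound))))

σ-*-coprime : ∀ {a b} → 0 < a → 0 < b → Coprime a b → σ (a * b) ≡ σ a * σ b
σ-*-coprime {a} {b} 0<a 0<b a⊥b = begin
  σ (a * b)                          ≡⟨ σ≡sum {a * b} (*-mono-< 0<a 0<b) products-unique sound complete ⟩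
  sum (map (uncurry _*_) pairs)      ≡⟨ sum-map-*-cartesianProduct (divisors a) (divisors b) ⟩
  σ a * σ b                          ∎
  where
  open ≡-Reasoning
  pairs = cartesianProduct (divisors a) (divisors b)
  products-unique : Unique (map (uncurry _*_) pairs)
  products-unique = unique-map⁺ (uncurry _*_) injective
    (Unique.cartesianProduct⁺ (divisors-unique a) (divisors-unique b))
    where
    injective : ∀ {x y} → x ∈ pairs → y ∈ pairs → uncurry _*_ x ≡ uncurry _*_ y → x ≡ y
    injective {d₁ , e₁} {d₂ , e₂} x∈ y∈ eq
      with d₁∈ , e₁∈ ← ∈-cartesianProduct⁻ (divisors a) (divisors b) x∈
         | d₂∈ , e₂∈ ← ∈-cartesianProduct⁻ (divisors a) (divisors b) y∈
      with refl , refl ← coprime-divisors-*-injective 0<a a⊥b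
             (∈-divisors⁻ d₁∈) (∈-divisors⁻ d₂∈) (∈-divisors⁻ e₁∈) (∈-divisors⁻ e₂∈) eq = refl
  sound : ∀ {c} → c ∈ map (uncurry _*_) pairs → c ∣ a * b
  sound c∈ with (d , e) , de∈ , refl ← ∈-map⁻ (uncurry _*_) c∈
    with d∈ , e∈ ← ∈-cartesianProduct⁻ (divisors a) (divisors b) de∈ =
    *-pres-∣ (∈-divisors⁻ {a} d∈) (∈-divisors⁻ {b} e∈)
  complete : ∀ {c} → c ∣ a * b → c ∈ map (uncurry _*_) pairs
  complete {c} c∣ab = subst (_∈ map (uncurry _*_) pairs) (sym (coprime-∣-*⇒≡gcd*gcd a⊥b c∣ab))
    (∈-map⁺ (uncurry _*_)
      (∈-cartesianProduct⁺ (∈-divisors⁺ 0<a (gcd[m,n]∣n c a)) (∈-divisors⁺ 0<b (gcd[m,n]∣n c b))))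

σ-prime^ : ∀ {p} → Prime p → ∀ k → σ (p ^ k) ≡ sum (map (p ^_) (downFrom (suc k)))
σ-prime^ {p} p-prime k = σ≡sum (m^n>0 p k) powers-unique sound complete
  where
  instance
    _ = prime⇒nonZero p-prime
    _ = prime⇒nonTrivial p-prime
  powers-unique : Unique (map (p ^_) (downFrom (suc k)))
  powers-unique = Unique.map⁺ (^-injectiveʳ p (nonTrivial⇒n>1 p)) (Unique.downFrom⁺ (suc k))
  sound : ∀ {d} → d ∈ map (p ^_) (downFrom (suc k)) → d ∣ p ^ k
  sound d∈ with i , i∈ , refl ← ∈-map⁻ (p ^_) d∈ = ^-monoʳ-∣ p (s≤s⁻¹ (∈-downFrom⁻ i∈))
  complete : ∀ {d} → d ∣ p ^ k → d ∈ map (p ^_) (downFrom (suc k))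
  complete d∣p^k with i , i≤k , refl ← ∣-prime^⇒≡^ p-prime k d∣p^k =
    ∈-map⁺ (p ^_) (∈-downFrom⁺ (s≤s i≤k))

geometric-sum : ∀ r k → sum (map (suc r ^_) (downFrom (suc k))) * r + 1 ≡ suc r ^ suc k
geometric-sum r zero    = begin
  (1 + 0) * r + 1    ≡⟨ solve (r ∷ []) ⟩
  suc r * 1          ∎
  where open ≡-Reasoning
geometric-sum r (suc k) = begin
  (x + s) * r + 1      ≡⟨ cong (_+ 1) (*-distribʳ-+ r x s) ⟩
  x * r + s * r + 1    ≡⟨ +-assoc (x * r) (s * r) 1 ⟩
  x * r + (s * r + 1)  ≡⟨ cong (x * r +_) (geometric-sum r k) ⟩
  x * r + x            ≡⟨ +-comm (x * r) x ⟩
  x + x * r            ≡⟨ cong (x +_) (*-comm x r) ⟩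
  suc r * x            ∎
  where
  open ≡-Reasoning
  x = suc r ^ suc k
  s = sum (map (suc r ^_) (downFrom (suc k)))

σ[p^k]*[p∸1]+1≡p^[1+k] : ∀ {p} → Prime p → ∀ k → σ (p ^ k) * (p ∸ 1) + 1 ≡ p ^ suc k
σ[p^k]*[p∸1]+1≡p^[1+k] {zero}  p-prime k = ⊥-elim (¬prime[0] p-prime)
σ[p^k]*[p∸1]+1≡p^[1+k] {suc r} p-prime k =
  trans (cong (λ t → t * r + 1) (σ-prime^ p-prime k)) (geometric-sum r k)

perfect⇒σ*σ≡2* : ∀ {N a b} → 0 < a → 0 < b → Coprime a b →
                 N ≡ a * b → σ N ≡ 2 * N → σ a * σ b ≡ 2 * (a * b)
perfect⇒σ*σ≡2* {N} {a} {b} 0<a 0<b a⊥b N≡ab σN≡2N = begin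
  σ a * σ b    ≡⟨ σ-*-coprime 0<a 0<b a⊥b ⟨
  σ (a * b)    ≡⟨ cong σ N≡ab ⟨
  σ N          ≡⟨ σN≡2N ⟩
  2 * N        ≡⟨ cong (2 *_) N≡ab ⟩
  2 * (a * b)  ∎
  where open ≡-Reasoning

x+2/x : ℕ → ℕ → ℚ
x+2/x a b = frac (a * a + 2 * (b * b)) (a * b)

rearrangement-< : ∀ {x y u v} → y < x → v < u → x * v + y * u < x * u + y * v
rearrangement-< {x} {y} {u} {v} y<x v<u
  with i , refl ← m≤n⇒∃[o]m+o≡n y<x | j , refl ← m≤n⇒∃[o]m+o≡n v<u = begin-strict
  x * v + y * u                  <⟨ m<m+n _ z<s ⟩
  x * v + y * u + suc i * suc j  ≡⟨ solve (y ∷ i ∷ v ∷ j ∷ []) ⟩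
  x * u + y * v                  ∎
  where open ≤-Reasoning

rearrangement-≤ : ∀ {x y u v} → y ≤ x → v ≤ u → x * v + y * u ≤ x * u + y * v
rearrangement-≤ {x} {y} {u} {v} y≤x v≤u
  with i , refl ← m≤n⇒∃[o]m+o≡n y≤x | j , refl ← m≤n⇒∃[o]m+o≡n v≤u = begin
  x * v + y * u          ≤⟨ m≤m+n _ (i * j) ⟩
  x * v + y * u + i * j  ≡⟨ solve (y ∷ i ∷ v ∷ j ∷ []) ⟩
  x * u + y * v          ∎
  where open ≤-Reasoning

-- With f x = x + 2/x, f (a/b) − f (c/d) = (cb − ad)(2bd − ac)/(abcd); cleared of
-- denominators, this is the rearrangement inequality for cb > ad and 2bd > ac.
x+2/x-antitone-< : ∀ {a b c d} → 0 < a * b → 0 < c * d →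
                   a * d < c * b → a * c < 2 * (b * d) → x+2/x c d ℚ.< x+2/x a b
x+2/x-antitone-< {a} {b} {c} {d} 0<ab 0<cd ad<cb ac<2bd = frac-< 0<cd 0<ab (begin-strict
  (c * c + 2 * (d * d)) * (a * b)          ≡⟨ solve (a ∷ b ∷ c ∷ d ∷ []) ⟩
  c * b * (a * c) + a * d * (2 * (b * d))  <⟨ rearrangement-< ad<cb ac<2bd ⟩
  c * b * (2 * (b * d)) + a * d * (a * c)  ≡⟨ solve (a ∷ b ∷ c ∷ d ∷ []) ⟩
  (a * a + 2 * (b * b)) * (c * d)          ∎)
  where open ≤-Reasoning

x+2/x-antitone-≤ : ∀ {a b c d} → 0 < a * b → 0 < c * d →
                   a * d ≤ c * b → a * c ≤ 2 * (b * d) → x+2/x c d ℚ.≤ x+2/x a b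
x+2/x-antitone-≤ {a} {b} {c} {d} 0<ab 0<cd ad≤cb ac≤2bd = frac-≤ 0<cd 0<ab (begin
  (c * c + 2 * (d * d)) * (a * b)          ≡⟨ solve (a ∷ b ∷ c ∷ d ∷ []) ⟩
  c * b * (a * c) + a * d * (2 * (b * d))  ≤⟨ rearrangement-≤ ad≤cb ac≤2bd ⟩
  c * b * (2 * (b * d)) + a * d * (a * c)  ≡⟨ solve (a ∷ b ∷ c ∷ d ∷ []) ⟩
  (a * a + 2 * (b * b)) * (c * d)          ∎)
  where open ≤-Reasoning

frac-+-frac≡x+2/x : ∀ {A B P M} → 0 < A → 0 < P → 0 < M →
                    A * B ≡ 2 * (P * M) → frac A P ℚ.+ frac B M ≡ x+2/x A P
frac-+-frac≡x+2/x {A} {B} {P} {M} 0<A 0<P 0<M AB≡2PM =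
  trans (frac-+ 0<P 0<M) (frac-cong (*-mono-< 0<P 0<M) (*-mono-< 0<A 0<P) (begin
    (A * M + B * P) * (A * P)                ≡⟨ solve (A ∷ B ∷ P ∷ M ∷ []) ⟩
    A * A * (P * M) + A * B * (P * P)        ≡⟨ cong (λ t → A * A * (P * M) + t * (P * P)) AB≡2PM ⟩
    A * A * (P * M) + 2 * (P * M) * (P * P)  ≡⟨ solve (A ∷ P ∷ M ∷ []) ⟩
    (A * A + 2 * (P * P)) * (P * M)          ∎))
  where open ≡-Reasoning

3≤n⇒[1+n]²≤2n² : ∀ {n} → 3 ≤ n → suc n * suc n ≤ 2 * (n * n)
3≤n⇒[1+n]²≤2n² {n} (s≤s (s≤s (s≤s {n = m} _))) = begin
  suc n * suc n                        ≤⟨ m≤m+n _ (2 + 4 * m + m * m) ⟩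
  suc n * suc n + (2 + 4 * m + m * m)  ≡⟨ solve (m ∷ []) ⟩
  2 * (n * n)                          ∎
  where open ≤-Reasoning

-- From here on p = suc r, P = p ^ k and A = σ P, tied by the relation (p − 1) A + 1 = p P.
geometric⇒0<A : ∀ {r A P} → 0 < r → 0 < P → A * r + 1 ≡ suc r * P → 0 < A
geometric⇒0<A {A = suc _} _ _ _ = z<s
geometric⇒0<A {A = zero} 0<r 0<P geometric = ⊥-elim (<⇒≢ (*-mono-≤ (s≤s 0<r) 0<P) geometric)

geometric⇒x+2/x-lower : ∀ {r A P} → 3 ≤ r → suc r ≤ P →
                        A * r + 1 ≡ suc r * P → x+2/x (suc r) r ℚ.< x+2/x A P
geometric⇒x+2/x-lower {r} {A} {P} 3≤r 1+r≤P geometric =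
  x+2/x-antitone-< {A} {P} {suc r} {r} 0<A*P (*-mono-< (z<s {r}) 0<r) Ar<[1+r]P A[1+r]<2Pr
  where
  0<r : 0 < r
  0<r = ≤-trans z<s 3≤r
  0<P : 0 < P
  0<P = ≤-trans z<s 1+r≤P
  0<A*P : 0 < A * P
  0<A*P = *-mono-< (geometric⇒0<A {A = A} 0<r 0<P geometric) 0<P
  instance _ = >-nonZero 0<r
  Ar<[1+r]P : A * r < suc r * P
  Ar<[1+r]P = subst (A * r <_) geometric (m<m+n (A * r) z<s)
  A[1+r]<2Pr : A * suc r < 2 * (P * r)
  A[1+r]<2Pr = *-cancelˡ-< r _ _ (begin-strict
    r * (A * suc r)                <⟨ m<m+n _ z<s ⟩
    r * (A * suc r) + suc r        ≡⟨ solve (r ∷ A ∷ []) ⟩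
    suc r * (A * r + 1)            ≡⟨ cong (suc r *_) geometric ⟩
    suc r * (suc r * P)            ≡⟨ *-assoc (suc r) (suc r) P ⟨
    suc r * suc r * P              ≤⟨ *-monoˡ-≤ P (3≤n⇒[1+n]²≤2n² 3≤r) ⟩
    2 * (r * r) * P                ≡⟨ solve (r ∷ P ∷ []) ⟩
    r * (2 * (P * r))              ∎)
    where open ≤-Reasoning

geometric⇒x+2/x-upper : ∀ {r A P} → 2 ≤ r → suc r ≤ P →
                        A * r + 1 ≡ suc r * P → x+2/x A P ℚ.≤ x+2/x (suc (suc r)) (suc r)
geometric⇒x+2/x-upper {r} {A} {P} 2≤r 1+r≤P geometric =
  x+2/x-antitone-≤ {2 + r} {suc r} {A} {P} z<s 0<A*P [2+r]P≤A[1+r] [2+r]A≤2[1+r]P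
  where
  0<r : 0 < r
  0<r = ≤-trans z<s 2≤r
  0<P : 0 < P
  0<P = ≤-trans z<s 1+r≤P
  0<A*P : 0 < A * P
  0<A*P = *-mono-< (geometric⇒0<A {A = A} 0<r 0<P geometric) 0<P
  instance _ = >-nonZero 0<r
  [2+r]P≤A[1+r] : (2 + r) * P ≤ A * suc r
  [2+r]P≤A[1+r] = *-cancelˡ-≤ r (+-cancelʳ-≤ (suc r) _ _ (begin
    r * ((2 + r) * P) + suc r      ≤⟨ +-monoʳ-≤ _ 1+r≤P ⟩
    r * ((2 + r) * P) + P          ≡⟨ solve (r ∷ P ∷ []) ⟩
    suc r * (suc r * P)            ≡⟨ cong (suc r *_) geometric ⟨
    suc r * (A * r + 1)            ≡⟨ solve (r ∷ A ∷ []) ⟩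
    r * (A * suc r) + suc r        ∎))
    where open ≤-Reasoning
  2+r≤2r : 2 + r ≤ 2 * r
  2+r≤2r = begin
    2 + r                          ≤⟨ +-monoˡ-≤ r 2≤r ⟩
    r + r                          ≡⟨ solve (r ∷ []) ⟩
    2 * r                          ∎
    where open ≤-Reasoning
  [2+r]A≤2[1+r]P : (2 + r) * A ≤ 2 * (suc r * P)
  [2+r]A≤2[1+r]P = *-cancelˡ-≤ r (begin
    r * ((2 + r) * A)              ≤⟨ m≤m+n _ (2 + r) ⟩
    r * ((2 + r) * A) + (2 + r)    ≡⟨ solve (r ∷ A ∷ []) ⟩
    (2 + r) * (A * r + 1)          ≡⟨ cong ((2 + r) *_) geometric ⟩
    (2 + r) * (suc r * P)          ≤⟨ *-monoˡ-≤ (suc r * P) 2+r≤2r ⟩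
    2 * r * (suc r * P)            ≡⟨ solve (r ∷ P ∷ []) ⟩
    r * (2 * (suc r * P))          ∎)
    where open ≤-Reasoning

prime≡1[mod4]⇒5≤p : ∀ {p} → Prime p → p % 4 ≡ 1 → 5 ≤ p
prime≡1[mod4]⇒5≤p {0} p-prime _ = ⊥-elim (¬prime[0] p-prime)
prime≡1[mod4]⇒5≤p {1} p-prime _ = ⊥-elim (¬prime[1] p-prime)
prime≡1[mod4]⇒5≤p {suc (suc (suc (suc (suc _))))} _ _ = s≤s (s≤s (s≤s (s≤s (s≤s z≤n))))

x+2/x-at-p/[p∸1] : ∀ {p} → 2 ≤ p → x+2/x p (p ∸ 1) ≡ frac (3 * p * p ∸ 4 * p + 2) (p * (p ∸ 1))
x+2/x-at-p/[p∸1] {p} (s≤s (s≤s {n = m} _)) = cong (λ t → frac t (p * suc m)) (begin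
  p * p + 2 * (suc m * suc m)                  ≡⟨ solve (m ∷ []) ⟩
  3 * m * m + 8 * m + 4 + 2                    ≡⟨ cong (_+ 2) (m+n∸n≡m (3 * m * m + 8 * m + 4) (4 * p)) ⟨
  (3 * m * m + 8 * m + 4) + 4 * p ∸ 4 * p + 2  ≡⟨ cong (λ t → t ∸ 4 * p + 2) 3p²≡3m²+8m+4+4p ⟨
  3 * p * p ∸ 4 * p + 2                        ∎)
  where
  open ≡-Reasoning
  3p²≡3m²+8m+4+4p : 3 * p * p ≡ (3 * m * m + 8 * m + 4) + 4 * p
  3p²≡3m²+8m+4+4p = solve (m ∷ [])

x+2/x-at-[p+1]/p : ∀ p → x+2/x (suc p) p ≡ frac (3 * p * p + 2 * p + 1) (p * (p + 1))
x+2/x-at-[p+1]/p p = cong₂ frac numerator denominator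
  where
  numerator : suc p * suc p + 2 * (p * p) ≡ 3 * p * p + 2 * p + 1
  numerator = solve (p ∷ [])
  denominator : suc p * p ≡ p * (p + 1)
  denominator = solve (p ∷ [])

corollary4p2p2 : (N p k m : ℕ) → Prime p → 1 ≤ k → 1 ≤ m
    → gcd p m ≡ 1 → N ≡ p ^ k * (m * m) → N % 2 ≡ 1 → σ N ≡ 2 * N
    → p % 4 ≡ 1 → k % 4 ≡ 1
    → (frac (3 * p * p ∸ 4 * p + 2) (p * (p ∸ 1)) ℚ.< frac (σ (p ^ k)) (p ^ k) ℚ.+ frac (σ (m * m)) (m * m))
    × (frac (σ (p ^ k)) (p ^ k) ℚ.+ frac (σ (m * m)) (m * m) ℚ.≤ frac (3 * p * p + 2 * p + 1) (p * (p + 1)))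
corollary4p2p2 N p k m p-prime 1≤k 1≤m gcd[p,m]≡1 N≡p^k*m² _ σN≡2N p≡1[4] _
  with s≤s {n = r} 4≤r ← prime≡1[mod4]⇒5≤p p-prime p≡1[4] =
    subst₂ ℚ._<_ (x+2/x-at-p/[p∸1] (s≤s 0<r)) (sym sum≡x+2/x)
      (geometric⇒x+2/x-lower {A = σ P} 3≤r p≤P geometric)
  , subst₂ ℚ._≤_ (sym sum≡x+2/x) (x+2/x-at-[p+1]/p p)
      (geometric⇒x+2/x-upper {A = σ P} 2≤r p≤P geometric)
  where
  3≤r : 3 ≤ r
  3≤r = <⇒≤ 4≤r
  2≤r : 2 ≤ r
  2≤r = ≤-trans (n≤1+n 2) 3≤r
  0<r : 0 < r
  0<r = ≤-trans (n≤1+n 1) 2≤r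
  P = p ^ k
  M = m * m
  0<P : 0 < P
  0<P = m^n>0 p k
  p≤P : p ≤ P
  p≤P = subst (_≤ P) (*-identityʳ p) (^-monoʳ-≤ p 1≤k)
  geometric : σ P * r + 1 ≡ p * P
  geometric = σ[p^k]*[p∸1]+1≡p^[1+k] p-prime k
  P⊥M : Coprime P M
  P⊥M = coprime-*ʳ (coprime-^ˡ k p⊥m) (coprime-^ˡ k p⊥m)
    where
    p⊥m : Coprime p m
    p⊥m = gcd≡1⇒coprime gcd[p,m]≡1
  sum≡x+2/x : frac (σ P) P ℚ.+ frac (σ M) M ≡ x+2/x (σ P) P
  sum≡x+2/x = frac-+-frac≡x+2/x (geometric⇒0<A {A = σ P} 0<r 0<P geometric) 0<P 0<M
                (perfect⇒σ*σ≡2* 0<P 0<M P⊥M N≡p^k*m² σN≡2N)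
    where
    0<M : 0 < M
    0<M = *-mono-< 1≤m 1≤m
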